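{- For $k\ge 1$ and $n=3^k$, $$\log\mathrm{DTSize}(\mathrm{MAJ}_3^{\otimes k})\ge \mathrm{Rank}(\mathrm{MAJ}_3^{\otimes k})\ge n/3+1.$$ For $k\ge 1$ and $n=4^k$, $$\log\mathrm{DTSize}((\mathrm{AND}_2\circ\mathrm{OR}_2)^{\otimes k})\ge \mathrm{Rank}((\mathrm{AND}_2\circ\mathrm{OR}_2)^{\otimes k})\ge n/4+1.$$
   Context: $\mathrm{MAJ}_3$ is the majority of 3 bits; $\mathrm{AND}_2\circ\mathrm{OR}_2(x_1,x_2,x_3,x_4)=(x_1\vee x_2)\wedge(x_3\vee x_4)$. For $f$ on $n$ variables and $g$ on $m$ variables, $f\circ g(a^1,\dots,a^n)=f(g(a^1),\dots,g(a^n))$; iterated composition $f^{\otimes1}=f$, $f^{\otimes k}=f\circ f^{\otimes(k-1)}$. A decision tree queries single variables and has $0/1$ leaves; $\mathrm{DTSize}(f)$ is the minimum number of leaves of a decision tree computing $f$. Rank of a rooted binary tree: leaves have rank $0$; an internal node with children of ranks $a,b$ has rank $a+1$ if $a=b$, else $\max\{a,b\}$; $\mathrm{Rank}(f)$ is the minimum rank of a decision tree computing $f$. Logarithms are base 2. -}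

module Defs where

open import Data.Nat using (ℕ; zero; suc; _+_; _*_; _^_; _≤_; _⊔_)
open import Data.Nat.Properties using (_≟_)
open import Data.Bool using (Bool; true; false; if_then_else_; _∧_; _∨_)
open import Data.Fin using (Fin; zero; suc; combine)
open import Data.Product using (Σ; _×_; _,_)
open import Relation.Nullary using (yes; no)
open import Relation.Binary.PropositionalEquality using (_≡_)

BF : ℕ → Set
BF n = (Fin n → Bool) → Bool

-- f ∘ g (a¹,…,aⁿ) = f (g a¹, …, g aⁿ); block i of the input consists of
-- the variables  combine i j  (j : Fin m), i.e. positions i*m+j.
_⊚_ : ∀ {n m} → BF n → BF m → BF (n * m)
(f ⊚ g) x = f (λ i → g (λ j → x (combine i j)))

-- iterated composition: f^{⊗0} is the 1-variable identity (projection),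
-- f^{⊗(k+1)} = f ∘ f^{⊗k}; thus f^{⊗1} = f ∘ id, which is f (on n*1 variables).
iter : ∀ {n} → BF n → (k : ℕ) → BF (n ^ k)
iter f zero    x = x zero
iter f (suc k) = f ⊚ iter f k

MAJ3 : BF 3
MAJ3 x = (x zero ∧ x (suc zero)) ∨ (x zero ∧ x (suc (suc zero))) ∨ (x (suc zero) ∧ x (suc (suc zero)))

AND2 : BF 2
AND2 x = x zero ∧ x (suc zero)

OR2 : BF 2
OR2 x = x zero ∨ x (suc zero)

AND2∘OR2 : BF 4
AND2∘OR2 = AND2 ⊚ OR2

data DT (n : ℕ) : Set where
  leaf : Bool → DT n
  node : Fin n → DT n → DT n → DT n

eval : ∀ {n} → DT n → (Fin n → Bool) → Bool
eval (leaf b) x = b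
eval (node i t₀ t₁) x = if x i then eval t₁ x else eval t₀ x

Computes : ∀ {n} → DT n → BF n → Set
Computes t f = ∀ x → eval t x ≡ f x

leaves : ∀ {n} → DT n → ℕ
leaves (leaf _) = 1
leaves (node _ t₀ t₁) = leaves t₀ + leaves t₁

rankNode : ℕ → ℕ → ℕ
rankNode a b with a ≟ b
... | yes _ = suc a
... | no _  = a ⊔ b

rank : ∀ {n} → DT n → ℕ
rank (leaf _) = 0
rank (node _ t₀ t₁) = rankNode (rank t₀) (rank t₁)

IsDTSize : ∀ {n} → BF n → ℕ → Set
IsDTSize {n} f s = Σ (DT n) (λ t → Computes t f × leaves t ≡ s)
                 × (∀ (t : DT n) → Computes t f → s ≤ leaves t)

IsRank : ∀ {n} → BF n → ℕ → Set
IsRank {n} f r = Σ (DT n) (λ t → Computes t f × rank t ≡ r)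
               × (∀ (t : DT n) → Computes t f → r ≤ rank t)

{-# OPTIONS --safe #-}
-- Delayer argument.  A restriction of the inputs of f^{⊗k} is summarised, bottom-up along the
-- composition tree, by the state of each restricted block: fixed to a constant, or live with a
-- potential P ≥ 1.  Fixing one more free variable changes these states only in ways allowed by
-- the rank recursion (Split), so a tree computing f on a subcube has rank at least the potential
-- of that subcube, and Rank f is at least the potential of the unrestricted function.  AND and
-- OR of live inputs have potential P₁ + P₂ − 1, and MAJ₃ with a fixed input is one of them; three
-- live inputs of MAJ₃ give P₁ + P₂ + P₃ − 1, four live inputs of AND₂∘OR₂ give P₁ + ⋯ + P₄ − 3,
-- but at least 2.  Hence the unrestricted potentials at depth k are at least 3^{k−1} + 1 and
-- 4^{k−1} + 1.  The size bound is 2^rank ≤ #leaves.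
module Submission where

open import Defs
open import Data.Nat using (ℕ; zero; suc; _+_; _*_; _^_; _≤_; _<_; _/_; _⊔_; z≤n; s≤s; NonZero)
open import Data.Nat.Properties
open import Data.Nat.DivMod using (m*n/n≡m)
open import Data.Nat.Tactic.RingSolver using (solve-∀)
open import Data.Bool using (Bool; true; false; if_then_else_; _∧_; _∨_)
open import Data.Bool.Properties using (∧-comm; ∧-zeroʳ; ∧-identityʳ; ∧-idem; ∨-zeroʳ; ∨-identityʳ; ∨-idem; ∨-abs-∧)
open import Data.Fin using (Fin; zero; suc; combine)
open import Data.Fin.Properties using (combine-injectiveˡ; combine-injectiveʳ; combine-surjective) renaming (_≟_ to _≟ᶠ_)
open import Data.Maybe using (Maybe; just; nothing; fromMaybe)
open import Data.Product using (_×_; _,_)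
open import Data.Sum using (inj₁; inj₂)
open import Data.Vec.Functional using (updateAt)
open import Data.Vec.Functional.Properties using (updateAt-updates; updateAt-minimal)
open import Function using (const; _∘_)
open import Relation.Nullary using (yes; no; contradiction)
open import Relation.Binary.PropositionalEquality using (_≡_; _≢_; _≗_; refl; sym; trans; cong; cong₂; subst; module ≡-Reasoning)

rankNode-≥ˡ : ∀ a b → a ≤ rankNode a b
rankNode-≥ˡ a b with a ≟ b
... | yes _ = n≤1+n a
... | no _  = m≤m⊔n a b

rankNode-≥ʳ : ∀ a b → b ≤ rankNode a b
rankNode-≥ʳ a b with a ≟ b
... | yes refl = n≤1+n a
... | no _     = m≤n⊔m a b

≤1+both⇒≤rankNode : ∀ {x} a b → x ≤ suc a → x ≤ suc b → x ≤ rankNode a b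
≤1+both⇒≤rankNode a b x≤1+a x≤1+b with a ≟ b
... | yes refl = x≤1+a
... | no a≢b with ≤-total a b
...   | inj₁ a≤b = ≤-trans x≤1+a (≤-trans (≤∧≢⇒< a≤b a≢b) (m≤n⊔m a b))
...   | inj₂ b≤a = ≤-trans x≤1+b (≤-trans (≤∧≢⇒< b≤a (a≢b ∘ sym)) (m≤m⊔n a b))

2^⊔≤2^+2^ : ∀ a b → 2 ^ (a ⊔ b) ≤ 2 ^ a + 2 ^ b
2^⊔≤2^+2^ a b with ≤-total a b
... | inj₁ a≤b rewrite m≤n⇒m⊔n≡n a≤b = m≤n+m (2 ^ b) (2 ^ a)
... | inj₂ b≤a rewrite m≥n⇒m⊔n≡m b≤a = m≤m+n (2 ^ a) (2 ^ b)

2^rankNode≤2^+2^ : ∀ a b → 2 ^ rankNode a b ≤ 2 ^ a + 2 ^ b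
2^rankNode≤2^+2^ a b with a ≟ b
... | yes refl = ≤-reflexive (cong (2 ^ a +_) (+-identityʳ (2 ^ a)))
... | no _     = 2^⊔≤2^+2^ a b

2^rank≤leaves : ∀ {n} (t : DT n) → 2 ^ rank t ≤ leaves t
2^rank≤leaves (leaf _)       = ≤-refl
2^rank≤leaves (node _ t₀ t₁) =
  ≤-trans (2^rankNode≤2^+2^ (rank t₀) (rank t₁)) (+-mono-≤ (2^rank≤leaves t₀) (2^rank≤leaves t₁))

2^Rank≤DTSize : ∀ {n} {f : BF n} {s r} → IsDTSize f s → IsRank f r → 2 ^ r ≤ s
2^Rank≤DTSize ((t , t-computes , refl) , _) (_ , rank-minimal) =
  ≤-trans (^-monoʳ-≤ 2 (rank-minimal t t-computes)) (2^rank≤leaves t)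

_[_]≔_ : ∀ {A : Set} {n} → (Fin n → A) → Fin n → A → Fin n → A
xs [ i ]≔ y = updateAt xs i (const y)

Restriction : ℕ → Set
Restriction n = Fin n → Maybe Bool

unrestricted : ∀ {n} → Restriction n
unrestricted _ = nothing

Extends : ∀ {n} → Restriction n → (Fin n → Bool) → Set
Extends ρ x = ∀ v {b} → ρ v ≡ just b → x v ≡ b

fill : ∀ {n} → Bool → Restriction n → Fin n → Bool
fill c ρ v = fromMaybe c (ρ v)

fill-extends : ∀ {n} c (ρ : Restriction n) → Extends ρ (fill c ρ)
fill-extends c ρ v ρv rewrite ρv = refl

extends-assigned : ∀ {n} {ρ : Restriction n} {i b x} → Extends (ρ [ i ]≔ just b) x → x i ≡ b
extends-assigned {ρ = ρ} {i} ext = ext i (updateAt-updates i ρ)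

extends-unassigned : ∀ {n} {ρ : Restriction n} {i b x} → ρ i ≡ nothing → Extends (ρ [ i ]≔ just b) x → Extends ρ x
extends-unassigned {ρ = ρ} {i} ρi ext v ρv with v ≟ᶠ i
... | yes refl = contradiction (trans (sym ρi) ρv) λ ()
... | no v≢i   = ext v (trans (updateAt-minimal v i ρ v≢i) ρv)

ComputesOn : ∀ {n} → DT n → BF n → Restriction n → Set
ComputesOn t F ρ = ∀ x → Extends ρ x → eval t x ≡ F x

computesOn-branch : ∀ {n} {i} {F ρ} b (t₀ t₁ : DT n) → (∀ x → Extends ρ x → x i ≡ b) →
                    ComputesOn (node i t₀ t₁) F ρ → ∀ x → Extends ρ x → (if b then eval t₁ x else eval t₀ x) ≡ F x
computesOn-branch b t₀ t₁ forced computes x ext =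
  trans (cong (λ c → if c then eval t₁ x else eval t₀ x) (sym (forced x ext))) (computes x ext)

-- live q : not (yet) constant, with potential q + 1
data State : Set where
  fixed : Bool → State
  live  : ℕ → State

potential : State → ℕ
potential (fixed _) = 0
potential (live q)  = suc q

-- the value of a state at the completion of the subcube by c
value : Bool → State → Bool
value c (fixed b) = b
value c (live _)  = c

-- Split s s₀ s₁ : s may become s₀ resp. s₁ when a free variable is set to 0 resp. 1
data Split : State → State → State → Set where
  stay   : ∀ {b} → Split (fixed b) (fixed b) (fixed b)
  keep₀  : ∀ {q q₀ s₁} → q ≤ q₀ → Split (live q) (live q₀) s₁
  keep₁  : ∀ {q s₀ q₁} → q ≤ q₁ → Split (live q) s₀ (live q₁)
  lose₁  : ∀ {q q₀ q₁} → q ≤ suc q₀ → q ≤ suc q₁ → Split (live q) (live q₀) (live q₁)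
  settle : Split (live 0) (fixed false) (fixed true)

split-refl : ∀ s → Split s s s
split-refl (fixed _) = stay
split-refl (live _)  = keep₀ ≤-refl

split-cong : ∀ {s s' s₀ s₀' s₁ s₁'} → s ≡ s' → s₀ ≡ s₀' → s₁ ≡ s₁' → Split s s₀ s₁ → Split s' s₀' s₁'
split-cong refl refl refl split = split

split-≗ : ∀ {h h' : State → State} → h ≗ h' → ∀ {s s₀ s₁} → Split (h s) (h s₀) (h s₁) → Split (h' s) (h' s₀) (h' s₁)
split-≗ h≗h' = split-cong (h≗h' _) (h≗h' _) (h≗h' _)

potential-≤-rankNode : ∀ {s s₀ s₁ a b} → Split s s₀ s₁ → potential s₀ ≤ a → potential s₁ ≤ b → potential s ≤ rankNode a b
potential-≤-rankNode stay _ _ = z≤n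
potential-≤-rankNode {a = a} {b} (keep₀ q≤q₀) p₀≤a _ = ≤-trans (s≤s q≤q₀) (≤-trans p₀≤a (rankNode-≥ˡ a b))
potential-≤-rankNode {a = a} {b} (keep₁ q≤q₁) _ p₁≤b = ≤-trans (s≤s q≤q₁) (≤-trans p₁≤b (rankNode-≥ʳ a b))
potential-≤-rankNode {a = a} {b} (lose₁ q≤1+q₀ q≤1+q₁) p₀≤a p₁≤b =
  ≤1+both⇒≤rankNode a b (≤-trans (s≤s q≤1+q₀) (s≤s p₀≤a)) (≤-trans (s≤s q≤1+q₁) (s≤s p₁≤b))
potential-≤-rankNode {a = a} {b} settle _ _ = ≤1+both⇒≤rankNode a b (s≤s z≤n) (s≤s z≤n)

-- The state of F on the subcube of ρ is read off F at the all-0 and all-1 completions of ρ;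
-- for the monotone functions considered here a live state is therefore non-constant.
module RankBound {n} (F : BF n) (state : Restriction n → State)
  (value-state : ∀ c ρ → value c (state ρ) ≡ F (fill c ρ))
  (split-state : ∀ ρ i → ρ i ≡ nothing → Split (state ρ) (state (ρ [ i ]≔ just false)) (state (ρ [ i ]≔ just true)))
  where

  potential-≤-rank : ∀ t ρ → ComputesOn t F ρ → potential (state ρ) ≤ rank t
  potential-≤-rank (leaf b) ρ computes with state ρ in eq
  ... | fixed _ = z≤n
  ... | live _  = contradiction (trans (leaf-value false) (sym (leaf-value true))) λ ()
    where
    leaf-value : ∀ c → c ≡ b
    leaf-value c = trans (cong (value c) (sym eq))
                         (trans (value-state c ρ) (sym (computes (fill c ρ) (fill-extends c ρ))))
  potential-≤-rank (node i t₀ t₁) ρ computes with ρ i in ρi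
  ... | just false = ≤-trans (potential-≤-rank t₀ ρ (computesOn-branch false t₀ t₁ (λ _ ext → ext i ρi) computes))
                             (rankNode-≥ˡ (rank t₀) (rank t₁))
  ... | just true  = ≤-trans (potential-≤-rank t₁ ρ (computesOn-branch true t₀ t₁ (λ _ ext → ext i ρi) computes))
                             (rankNode-≥ʳ (rank t₀) (rank t₁))
  ... | nothing    = potential-≤-rankNode (split-state ρ i ρi)
                       (potential-≤-rank t₀ (ρ [ i ]≔ just false) (assign false))
                       (potential-≤-rank t₁ (ρ [ i ]≔ just true) (assign true))
    where
    assign : ∀ b x → Extends (ρ [ i ]≔ just b) x → (if b then eval t₁ x else eval t₀ x) ≡ F x
    assign b = computesOn-branch b t₀ t₁ (λ _ → extends-assigned)
                 (λ x ext → computes x (extends-unassigned ρi ext))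

  potential-≤-Rank : ∀ {r} → IsRank F r → potential (state unrestricted) ≤ r
  potential-≤-Rank ((t , computes , refl) , _) = potential-≤-rank t unrestricted (λ x _ → computes x)

module Composition {m} (g : BF m) (gate : (Fin m → State) → State)
  (gate-value : ∀ c (f : Fin m → State) (v : Fin m → Bool) → (∀ j → value c (f j) ≡ v j) → value c (gate f) ≡ g v)
  (gate-cong : ∀ {f f' : Fin m → State} → f ≗ f' → gate f ≡ gate f')
  (gate-split : ∀ (f : Fin m → State) j {s₀ s₁} → Split (f j) s₀ s₁ → Split (gate f) (gate (f [ j ]≔ s₀)) (gate (f [ j ]≔ s₁)))
  where

  variableState : Maybe Bool → State
  variableState nothing  = live 0
  variableState (just b) = fixed b

  block : ∀ {n} → Restriction (m * n) → Fin m → Restriction n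
  block ρ j l = ρ (combine j l)

  state : ∀ k → Restriction (m ^ k) → State
  state zero    ρ = variableState (ρ zero)
  state (suc k) ρ = gate (λ j → state k (block ρ j))

  state-cong : ∀ k {ρ ρ' : Restriction (m ^ k)} → ρ ≗ ρ' → state k ρ ≡ state k ρ'
  state-cong zero    ρ≗ρ' = cong variableState (ρ≗ρ' zero)
  state-cong (suc k) ρ≗ρ' = gate-cong (λ j → state-cong k (λ l → ρ≗ρ' (combine j l)))

  value-state : ∀ k c ρ → value c (state k ρ) ≡ iter g k (fill c ρ)
  value-state zero c ρ with ρ zero
  ... | nothing = refl
  ... | just _  = refl
  value-state (suc k) c ρ = gate-value c _ _ (λ j → value-state k c (block ρ j))

  block-assign-same : ∀ {n} (ρ : Restriction (m * n)) j l b → block (ρ [ combine j l ]≔ b) j ≗ block ρ j [ l ]≔ b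
  block-assign-same ρ j l b l' with l' ≟ᶠ l
  ... | yes refl = trans (updateAt-updates (combine j l) ρ) (sym (updateAt-updates l (block ρ j)))
  ... | no l'≢l  = trans (updateAt-minimal _ _ ρ (l'≢l ∘ combine-injectiveʳ j l' j l))
                         (sym (updateAt-minimal l' l (block ρ j) l'≢l))

  block-assign-other : ∀ {n} (ρ : Restriction (m * n)) j l b j' → j' ≢ j → block (ρ [ combine j l ]≔ b) j' ≗ block ρ j'
  block-assign-other ρ j l b j' j'≢j l' = updateAt-minimal _ _ ρ (j'≢j ∘ combine-injectiveˡ j' l' j l)

  state-assign : ∀ k (ρ : Restriction (m * m ^ k)) j l b →
                 (λ j' → state k (block (ρ [ combine j l ]≔ b) j')) ≗
                 (λ j' → state k (block ρ j')) [ j ]≔ state k (block ρ j [ l ]≔ b)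
  state-assign k ρ j l b j' with j' ≟ᶠ j
  ... | yes refl = trans (state-cong k (block-assign-same ρ j l b)) (sym (updateAt-updates j _))
  ... | no j'≢j  = trans (state-cong k (block-assign-other ρ j l b j' j'≢j)) (sym (updateAt-minimal j' j _ j'≢j))

  split-state : ∀ k ρ i → ρ i ≡ nothing → Split (state k ρ) (state k (ρ [ i ]≔ just false)) (state k (ρ [ i ]≔ just true))
  split-state zero ρ zero ρi rewrite ρi = settle
  split-state (suc k) ρ i ρi with combine-surjective {m} {m ^ k} i
  ... | j , l , refl = split-cong refl (sym (gate-cong (state-assign k ρ j l (just false))))
                                       (sym (gate-cong (state-assign k ρ j l (just true))))
                         (gate-split _ j (split-state k (block ρ j) l ρi))

  live<Rank : ∀ k {q r} → state k unrestricted ≡ live q → IsRank (iter g k) r → q < r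
  live<Rank k eq = subst (λ s → potential s ≤ _) eq
                 ∘ RankBound.potential-≤-Rank (iter g k) (state k) (value-state k) (split-state k)

infixr 6 _∧ˢ_
infixr 5 _∨ˢ_

_∧ˢ_ : State → State → State
fixed false ∧ˢ t           = fixed false
fixed true  ∧ˢ t           = t
live p      ∧ˢ fixed false = fixed false
live p      ∧ˢ fixed true  = live p
live p      ∧ˢ live q      = live (p + q)

_∨ˢ_ : State → State → State
fixed true  ∨ˢ t           = fixed true
fixed false ∨ˢ t           = t
live p      ∨ˢ fixed true  = fixed true
live p      ∨ˢ fixed false = live p
live p      ∨ˢ live q      = live (p + q)

value-∧ˢ : ∀ c s t → value c (s ∧ˢ t) ≡ value c s ∧ value c t
value-∧ˢ c (fixed false) t           = refl
value-∧ˢ c (fixed true)  t           = refl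
value-∧ˢ c (live p)      (fixed false) = sym (∧-zeroʳ c)
value-∧ˢ c (live p)      (fixed true)  = sym (∧-identityʳ c)
value-∧ˢ c (live p)      (live q)      = sym (∧-idem c)

value-∨ˢ : ∀ c s t → value c (s ∨ˢ t) ≡ value c s ∨ value c t
value-∨ˢ c (fixed true)  t             = refl
value-∨ˢ c (fixed false) t             = refl
value-∨ˢ c (live p)      (fixed true)  = sym (∨-zeroʳ c)
value-∨ˢ c (live p)      (fixed false) = sym (∨-identityʳ c)
value-∨ˢ c (live p)      (live q)      = sym (∨-idem c)

∧ˢ-comm : ∀ s t → s ∧ˢ t ≡ t ∧ˢ s
∧ˢ-comm (fixed false) (fixed false) = refl
∧ˢ-comm (fixed false) (fixed true)  = refl
∧ˢ-comm (fixed true)  (fixed false) = refl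
∧ˢ-comm (fixed true)  (fixed true)  = refl
∧ˢ-comm (fixed false) (live q)      = refl
∧ˢ-comm (fixed true)  (live q)      = refl
∧ˢ-comm (live p)      (fixed false) = refl
∧ˢ-comm (live p)      (fixed true)  = refl
∧ˢ-comm (live p)      (live q)      = cong live (+-comm p q)

∨ˢ-comm : ∀ s t → s ∨ˢ t ≡ t ∨ˢ s
∨ˢ-comm (fixed false) (fixed false) = refl
∨ˢ-comm (fixed false) (fixed true)  = refl
∨ˢ-comm (fixed true)  (fixed false) = refl
∨ˢ-comm (fixed true)  (fixed true)  = refl
∨ˢ-comm (fixed false) (live q)      = refl
∨ˢ-comm (fixed true)  (live q)      = refl
∨ˢ-comm (live p)      (fixed false) = refl
∨ˢ-comm (live p)      (fixed true)  = refl
∨ˢ-comm (live p)      (live q)      = cong live (+-comm p q)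

+-monoʳ-≤-suc : ∀ p {q r} → q ≤ suc r → p + q ≤ suc (p + r)
+-monoʳ-≤-suc p {q} {r} q≤1+r = ≤-trans (+-monoʳ-≤ p q≤1+r) (≤-reflexive (+-suc p r))

∧ˢ-splitʳ : ∀ s {t t₀ t₁} → Split t t₀ t₁ → Split (s ∧ˢ t) (s ∧ˢ t₀) (s ∧ˢ t₁)
∧ˢ-splitʳ (fixed false) _                     = stay
∧ˢ-splitʳ (fixed true)  split                 = split
∧ˢ-splitʳ (live p)      (stay {b})            = split-refl (live p ∧ˢ fixed b)
∧ˢ-splitʳ (live p)      (keep₀ q≤q₀)          = keep₀ (+-monoʳ-≤ p q≤q₀)
∧ˢ-splitʳ (live p)      (keep₁ q≤q₁)          = keep₁ (+-monoʳ-≤ p q≤q₁)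
∧ˢ-splitʳ (live p)      (lose₁ q≤1+q₀ q≤1+q₁) = lose₁ (+-monoʳ-≤-suc p q≤1+q₀) (+-monoʳ-≤-suc p q≤1+q₁)
∧ˢ-splitʳ (live p)      settle                = keep₁ (≤-reflexive (+-identityʳ p))

∨ˢ-splitʳ : ∀ s {t t₀ t₁} → Split t t₀ t₁ → Split (s ∨ˢ t) (s ∨ˢ t₀) (s ∨ˢ t₁)
∨ˢ-splitʳ (fixed true)  _                     = stay
∨ˢ-splitʳ (fixed false) split                 = split
∨ˢ-splitʳ (live p)      (stay {b})            = split-refl (live p ∨ˢ fixed b)
∨ˢ-splitʳ (live p)      (keep₀ q≤q₀)          = keep₀ (+-monoʳ-≤ p q≤q₀)
∨ˢ-splitʳ (live p)      (keep₁ q≤q₁)          = keep₁ (+-monoʳ-≤ p q≤q₁)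
∨ˢ-splitʳ (live p)      (lose₁ q≤1+q₀ q≤1+q₁) = lose₁ (+-monoʳ-≤-suc p q≤1+q₀) (+-monoʳ-≤-suc p q≤1+q₁)
∨ˢ-splitʳ (live p)      settle                = keep₀ (≤-reflexive (+-identityʳ p))

∧ˢ-splitˡ : ∀ {s s₀ s₁} → Split s s₀ s₁ → ∀ t → Split (s ∧ˢ t) (s₀ ∧ˢ t) (s₁ ∧ˢ t)
∧ˢ-splitˡ split t = split-≗ (∧ˢ-comm t) (∧ˢ-splitʳ t split)

∨ˢ-splitˡ : ∀ {s s₀ s₁} → Split s s₀ s₁ → ∀ t → Split (s ∨ˢ t) (s₀ ∨ˢ t) (s₁ ∨ˢ t)
∨ˢ-splitˡ split t = split-≗ (∨ˢ-comm t) (∨ˢ-splitʳ t split)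

m^[1+k]/m+1≤ : ∀ m k {q r} .{{_ : NonZero m}} → m ^ k ≤ q → q < r → m ^ suc k / m + 1 ≤ r
m^[1+k]/m+1≤ m k {q} {r} m^k≤q q<r = begin
  m ^ suc k / m + 1 ≡⟨ cong (λ x → x / m + 1) (*-comm m (m ^ k)) ⟩
  m ^ k * m / m + 1 ≡⟨ cong (_+ 1) (m*n/n≡m (m ^ k) m) ⟩
  m ^ k + 1         ≡⟨ +-comm (m ^ k) 1 ⟩
  suc (m ^ k)       ≤⟨ s≤s m^k≤q ⟩
  suc q             ≤⟨ q<r ⟩
  r                 ∎
  where open ≤-Reasoning

module Majority where

  maj : Bool → Bool → Bool → Bool
  maj x y z = (x ∧ y) ∨ (x ∧ z) ∨ (y ∧ z)

  maj-true : ∀ y z → maj true y z ≡ y ∨ z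
  maj-true y z = cong (y ∨_) (trans (cong (z ∨_) (∧-comm y z)) (∨-abs-∧ z y))

  maj-swap₁₂ : ∀ x y z → maj x y z ≡ maj y x z
  maj-swap₁₂ false false z = refl
  maj-swap₁₂ false true  z = sym (∨-identityʳ z)
  maj-swap₁₂ true  false z = ∨-identityʳ z
  maj-swap₁₂ true  true  z = refl

  maj-idem : ∀ x z → maj x x z ≡ x
  maj-idem false z = refl
  maj-idem true  z = refl

  opˢ : Bool → State → State → State
  opˢ false = _∧ˢ_
  opˢ true  = _∨ˢ_

  opˢ-comm : ∀ b s t → opˢ b s t ≡ opˢ b t s
  opˢ-comm false = ∧ˢ-comm
  opˢ-comm true  = ∨ˢ-comm

  opˢ-splitˡ : ∀ b {s s₀ s₁} → Split s s₀ s₁ → ∀ t → Split (opˢ b s t) (opˢ b s₀ t) (opˢ b s₁ t)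
  opˢ-splitˡ false = ∧ˢ-splitˡ
  opˢ-splitˡ true  = ∨ˢ-splitˡ

  majˢ : State → State → State → State
  majˢ (fixed b) t         u         = opˢ b t u
  majˢ (live p)  (fixed b) u         = opˢ b (live p) u
  majˢ (live p)  (live q)  (fixed b) = opˢ b (live p) (live q)
  majˢ (live p)  (live q)  (live r)  = live (suc (p + q + r))

  value-majˢ : ∀ c s t u → value c (majˢ s t u) ≡ maj (value c s) (value c t) (value c u)
  value-majˢ c (fixed false) t u = value-∧ˢ c t u
  value-majˢ c (fixed true)  t u = trans (value-∨ˢ c t u) (sym (maj-true (value c t) (value c u)))
  value-majˢ c (live p) (fixed false) u = trans (value-∧ˢ c (live p) u) (sym (maj-swap₁₂ c false _))
  value-majˢ c (live p) (fixed true)  u =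
    trans (value-∨ˢ c (live p) u) (sym (trans (maj-swap₁₂ c true _) (maj-true c _)))
  value-majˢ c (live p) (live q) (fixed false) = sym (maj-idem c false)
  value-majˢ c (live p) (live q) (fixed true)  = sym (maj-idem c true)
  value-majˢ c (live p) (live q) (live r)      = sym (maj-idem c c)

  majˢ-fixed₂ : ∀ s b u → majˢ s (fixed b) u ≡ opˢ b s u
  majˢ-fixed₂ (fixed false) false u = refl
  majˢ-fixed₂ (fixed false) true  u = refl
  majˢ-fixed₂ (fixed true)  false u = refl
  majˢ-fixed₂ (fixed true)  true  u = refl
  majˢ-fixed₂ (live p)      b     u = refl

  majˢ-swap₁₂ : ∀ s t u → majˢ s t u ≡ majˢ t s u
  majˢ-swap₁₂ (fixed a) (fixed b) u         = majˢ-fixed₂ (fixed a) b u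
  majˢ-swap₁₂ (fixed a) (live q)  u         = refl
  majˢ-swap₁₂ (live p)  (fixed b) u         = refl
  majˢ-swap₁₂ (live p)  (live q)  (fixed b) = opˢ-comm b (live p) (live q)
  majˢ-swap₁₂ (live p)  (live q)  (live r)  = cong (λ x → live (suc (x + r))) (+-comm p q)

  majˢ-swap₂₃ : ∀ s t u → majˢ s t u ≡ majˢ s u t
  majˢ-swap₂₃ (fixed a) t             u             = opˢ-comm a t u
  majˢ-swap₂₃ (live p)  (fixed false) (fixed false) = refl
  majˢ-swap₂₃ (live p)  (fixed false) (fixed true)  = refl
  majˢ-swap₂₃ (live p)  (fixed true)  (fixed false) = refl
  majˢ-swap₂₃ (live p)  (fixed true)  (fixed true)  = refl
  majˢ-swap₂₃ (live p)  (fixed b)     (live r)      = refl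
  majˢ-swap₂₃ (live p)  (live q)      (fixed c)     = refl
  majˢ-swap₂₃ (live p)  (live q)      (live r)      = cong (live ∘ suc) (+-assoc-comm p q r)
    where
    +-assoc-comm : ∀ p q r → p + q + r ≡ p + r + q
    +-assoc-comm = solve-∀

  majˢ-split₁ : ∀ {s s₀ s₁} → Split s s₀ s₁ → ∀ t u → Split (majˢ s t u) (majˢ s₀ t u) (majˢ s₁ t u)
  majˢ-split₁ split (fixed b) u = split-≗ (λ x → sym (majˢ-fixed₂ x b u)) (opˢ-splitˡ b split u)
  majˢ-split₁ split (live q) (fixed b) =
    split-≗ (λ x → trans (sym (majˢ-fixed₂ x b (live q))) (majˢ-swap₂₃ x (fixed b) (live q)))
            (opˢ-splitˡ b split (live q))
  majˢ-split₁ stay                  (live q) (live r) = split-refl _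
  majˢ-split₁ (keep₀ p≤p₀)          (live q) (live r) = keep₀ (s≤s (+-monoˡ-≤ r (+-monoˡ-≤ q p≤p₀)))
  majˢ-split₁ (keep₁ p≤p₁)          (live q) (live r) = keep₁ (s≤s (+-monoˡ-≤ r (+-monoˡ-≤ q p≤p₁)))
  majˢ-split₁ (lose₁ p≤1+p₀ p≤1+p₁) (live q) (live r) =
    lose₁ (s≤s (+-monoˡ-≤ r (+-monoˡ-≤ q p≤1+p₀))) (s≤s (+-monoˡ-≤ r (+-monoˡ-≤ q p≤1+p₁)))
  majˢ-split₁ settle                (live q) (live r) = lose₁ ≤-refl ≤-refl

  majˢ-split₂ : ∀ {s s₀ s₁} → Split s s₀ s₁ → ∀ t u → Split (majˢ t s u) (majˢ t s₀ u) (majˢ t s₁ u)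
  majˢ-split₂ split t u = split-≗ (λ x → majˢ-swap₁₂ x t u) (majˢ-split₁ split t u)

  majˢ-split₃ : ∀ {s s₀ s₁} → Split s s₀ s₁ → ∀ t u → Split (majˢ t u s) (majˢ t u s₀) (majˢ t u s₁)
  majˢ-split₃ split t u = split-≗ (λ x → majˢ-swap₂₃ t x u) (majˢ-split₂ split t u)

  gate : (Fin 3 → State) → State
  gate f = majˢ (f zero) (f (suc zero)) (f (suc (suc zero)))

  gate-value : ∀ c f (v : Fin 3 → Bool) → (∀ j → value c (f j) ≡ v j) → value c (gate f) ≡ MAJ3 v
  gate-value c f v f≡v rewrite sym (f≡v zero) | sym (f≡v (suc zero)) | sym (f≡v (suc (suc zero))) =
    value-majˢ c (f zero) (f (suc zero)) (f (suc (suc zero)))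

  gate-cong : ∀ {f f' : Fin 3 → State} → f ≗ f' → gate f ≡ gate f'
  gate-cong f≗f' rewrite f≗f' zero | f≗f' (suc zero) | f≗f' (suc (suc zero)) = refl

  gate-split : ∀ f j {s₀ s₁} → Split (f j) s₀ s₁ → Split (gate f) (gate (f [ j ]≔ s₀)) (gate (f [ j ]≔ s₁))
  gate-split f zero             split = majˢ-split₁ split (f (suc zero)) (f (suc (suc zero)))
  gate-split f (suc zero)       split = majˢ-split₂ split (f zero) (f (suc (suc zero)))
  gate-split f (suc (suc zero)) split = majˢ-split₃ split (f zero) (f (suc zero))

  open Composition MAJ3 gate gate-value gate-cong gate-split using (state; live<Rank)

  initial : ℕ → ℕ
  initial zero    = 0
  initial (suc k) = suc (initial k + initial k + initial k)

  state-unrestricted : ∀ k → state k unrestricted ≡ live (initial k)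
  state-unrestricted zero = refl
  state-unrestricted (suc k) rewrite state-unrestricted k = refl

  3^k≤initial : ∀ k → 3 ^ k ≤ initial (suc k)
  3^k≤initial zero    = ≤-refl
  3^k≤initial (suc k) = begin
    3 * 3 ^ k     ≤⟨ *-monoʳ-≤ 3 (3^k≤initial k) ⟩
    3 * q         ≡⟨ triple q ⟩
    q + q + q     ≤⟨ n≤1+n _ ⟩
    initial (suc (suc k)) ∎
    where
    open ≤-Reasoning
    q = initial (suc k)
    triple : ∀ x → 3 * x ≡ x + x + x
    triple = solve-∀

  initial<Rank : ∀ k {r} → IsRank (iter MAJ3 k) r → initial k < r
  initial<Rank k = live<Rank k (state-unrestricted k)

module AndOr where

  isLive : State → Bool
  isLive (fixed _) = false
  isLive (live _)  = true

  allLive : State → State → State → State → Bool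
  allLive s t u v = (isLive s ∧ isLive t) ∧ (isLive u ∧ isLive v)

  raiseIf : Bool → State → State
  raiseIf false s         = s
  raiseIf true  (fixed b) = fixed b
  raiseIf true  (live q)  = live (1 ⊔ q)

  -- the additive rule gives (x₁ ∨ x₂) ∧ (x₃ ∨ x₄) potential 1, but its rank is 2
  andOrˢ : State → State → State → State → State
  andOrˢ s t u v = raiseIf (allLive s t u v) ((s ∨ˢ t) ∧ˢ (u ∨ˢ v))

  value-raiseIf : ∀ c b s → value c (raiseIf b s) ≡ value c s
  value-raiseIf c false s         = refl
  value-raiseIf c true  (fixed b) = refl
  value-raiseIf c true  (live q)  = refl

  value-andOrˢ : ∀ c s t u v → value c (andOrˢ s t u v) ≡ (value c s ∨ value c t) ∧ (value c u ∨ value c v)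
  value-andOrˢ c s t u v = begin
    value c (andOrˢ s t u v)                          ≡⟨ value-raiseIf c (allLive s t u v) _ ⟩
    value c ((s ∨ˢ t) ∧ˢ (u ∨ˢ v))                    ≡⟨ value-∧ˢ c (s ∨ˢ t) (u ∨ˢ v) ⟩
    value c (s ∨ˢ t) ∧ value c (u ∨ˢ v)               ≡⟨ cong₂ _∧_ (value-∨ˢ c s t) (value-∨ˢ c u v) ⟩
    (value c s ∨ value c t) ∧ (value c u ∨ value c v) ∎
    where open ≡-Reasoning

  andOrˢ-swap₁₂ : ∀ s t u v → andOrˢ s t u v ≡ andOrˢ t s u v
  andOrˢ-swap₁₂ s t u v =
    cong₂ raiseIf (cong (_∧ (isLive u ∧ isLive v)) (∧-comm (isLive s) (isLive t)))
                  (cong (_∧ˢ (u ∨ˢ v)) (∨ˢ-comm s t))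

  andOrˢ-swap-pairs : ∀ s t u v → andOrˢ s t u v ≡ andOrˢ u v s t
  andOrˢ-swap-pairs s t u v =
    cong₂ raiseIf (∧-comm (isLive s ∧ isLive t) (isLive u ∧ isLive v)) (∧ˢ-comm (s ∨ˢ t) (u ∨ˢ v))

  split-unraised : ∀ {s s₀ s₁} t u v → (∀ x → allLive x t u v ≡ false) → Split s s₀ s₁ →
                   Split (andOrˢ s t u v) (andOrˢ s₀ t u v) (andOrˢ s₁ t u v)
  split-unraised t u v unraised split =
    split-≗ (λ x → cong (λ b → raiseIf b ((x ∨ˢ t) ∧ˢ (u ∨ˢ v))) (sym (unraised x))) (∧ˢ-splitˡ (∨ˢ-splitˡ split t) (u ∨ˢ v))

  1⊔-≤-suc : ∀ {x y} → x ≤ suc y → 1 ⊔ x ≤ suc (1 ⊔ y)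
  1⊔-≤-suc {y = y} x≤1+y = ⊔-lub (s≤s z≤n) (≤-trans x≤1+y (s≤s (m≤n⊔m 1 y)))

  andOrˢ-split₁ : ∀ {s s₀ s₁} → Split s s₀ s₁ → ∀ t u v →
                  Split (andOrˢ s t u v) (andOrˢ s₀ t u v) (andOrˢ s₁ t u v)
  andOrˢ-split₁ split (fixed b) u v =
    split-unraised (fixed b) u v (λ x → cong (_∧ (isLive u ∧ isLive v)) (∧-zeroʳ (isLive x))) split
  andOrˢ-split₁ split (live q) (fixed b) v =
    split-unraised (live q) (fixed b) v (λ x → ∧-zeroʳ (isLive x ∧ true)) split
  andOrˢ-split₁ split (live q) (live r) (fixed b) =
    split-unraised (live q) (live r) (fixed b) (λ x → ∧-zeroʳ (isLive x ∧ true)) split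
  andOrˢ-split₁ stay (live q) (live r) (live w) = split-refl _
  andOrˢ-split₁ (keep₀ p≤p₀) (live q) (live r) (live w) =
    keep₀ (⊔-monoʳ-≤ 1 (+-monoˡ-≤ (r + w) (+-monoˡ-≤ q p≤p₀)))
  andOrˢ-split₁ (keep₁ p≤p₁) (live q) (live r) (live w) =
    keep₁ (⊔-monoʳ-≤ 1 (+-monoˡ-≤ (r + w) (+-monoˡ-≤ q p≤p₁)))
  andOrˢ-split₁ (lose₁ p≤1+p₀ p≤1+p₁) (live q) (live r) (live w) =
    lose₁ (1⊔-≤-suc (+-monoˡ-≤ (r + w) (+-monoˡ-≤ q p≤1+p₀)))
          (1⊔-≤-suc (+-monoˡ-≤ (r + w) (+-monoˡ-≤ q p≤1+p₁)))
  andOrˢ-split₁ settle (live zero) (live r) (live w) =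
    lose₁ (⊔-lub (s≤s z≤n) (n≤1+n (r + w))) (⊔-lub (s≤s z≤n) (n≤1+n (r + w)))
  andOrˢ-split₁ settle (live (suc q)) (live r) (live w) = keep₀ ≤-refl

  andOrˢ-split₂ : ∀ {s s₀ s₁} → Split s s₀ s₁ → ∀ t u v →
                  Split (andOrˢ t s u v) (andOrˢ t s₀ u v) (andOrˢ t s₁ u v)
  andOrˢ-split₂ split t u v = split-≗ (λ x → andOrˢ-swap₁₂ x t u v) (andOrˢ-split₁ split t u v)

  andOrˢ-split₃ : ∀ {s s₀ s₁} → Split s s₀ s₁ → ∀ t u v →
                  Split (andOrˢ t u s v) (andOrˢ t u s₀ v) (andOrˢ t u s₁ v)
  andOrˢ-split₃ split t u v = split-≗ (λ x → andOrˢ-swap-pairs x v t u) (andOrˢ-split₁ split v t u)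

  andOrˢ-split₄ : ∀ {s s₀ s₁} → Split s s₀ s₁ → ∀ t u v →
                  Split (andOrˢ t u v s) (andOrˢ t u v s₀) (andOrˢ t u v s₁)
  andOrˢ-split₄ split t u v = split-≗ (λ x → andOrˢ-swap-pairs v x t u) (andOrˢ-split₂ split v t u)

  gate : (Fin 4 → State) → State
  gate f = andOrˢ (f zero) (f (suc zero)) (f (suc (suc zero))) (f (suc (suc (suc zero))))

  gate-value : ∀ c f (v : Fin 4 → Bool) → (∀ j → value c (f j) ≡ v j) → value c (gate f) ≡ AND2∘OR2 v
  gate-value c f v f≡v
    rewrite sym (f≡v zero) | sym (f≡v (suc zero)) | sym (f≡v (suc (suc zero))) | sym (f≡v (suc (suc (suc zero)))) =
    value-andOrˢ c (f zero) (f (suc zero)) (f (suc (suc zero))) (f (suc (suc (suc zero))))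

  gate-cong : ∀ {f f' : Fin 4 → State} → f ≗ f' → gate f ≡ gate f'
  gate-cong f≗f'
    rewrite f≗f' zero | f≗f' (suc zero) | f≗f' (suc (suc zero)) | f≗f' (suc (suc (suc zero))) = refl

  gate-split : ∀ f j {s₀ s₁} → Split (f j) s₀ s₁ → Split (gate f) (gate (f [ j ]≔ s₀)) (gate (f [ j ]≔ s₁))
  gate-split f zero                   split = andOrˢ-split₁ split (f (suc zero)) (f (suc (suc zero))) (f (suc (suc (suc zero))))
  gate-split f (suc zero)             split = andOrˢ-split₂ split (f zero) (f (suc (suc zero))) (f (suc (suc (suc zero))))
  gate-split f (suc (suc zero))       split = andOrˢ-split₃ split (f zero) (f (suc zero)) (f (suc (suc (suc zero))))
  gate-split f (suc (suc (suc zero))) split = andOrˢ-split₄ split (f zero) (f (suc zero)) (f (suc (suc zero)))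

  open Composition AND2∘OR2 gate gate-value gate-cong gate-split using (state; live<Rank)

  initial : ℕ → ℕ
  initial zero    = 0
  initial (suc k) = 1 ⊔ (initial k + initial k + (initial k + initial k))

  state-unrestricted : ∀ k → state k unrestricted ≡ live (initial k)
  state-unrestricted zero = refl
  state-unrestricted (suc k) rewrite state-unrestricted k = refl

  4^k≤initial : ∀ k → 4 ^ k ≤ initial (suc k)
  4^k≤initial zero    = ≤-refl
  4^k≤initial (suc k) = begin
    4 * 4 ^ k           ≤⟨ *-monoʳ-≤ 4 (4^k≤initial k) ⟩
    4 * q               ≡⟨ quadruple q ⟩
    q + q + (q + q)     ≤⟨ m≤n⊔m 1 _ ⟩
    initial (suc (suc k)) ∎
    where
    open ≤-Reasoning
    q = initial (suc k)
    quadruple : ∀ x → 4 * x ≡ x + x + (x + x)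
    quadruple = solve-∀

  initial<Rank : ∀ k {r} → IsRank (iter AND2∘OR2 k) r → initial k < r
  initial<Rank k = live<Rank k (state-unrestricted k)

corollary7p1 : (∀ (k n : ℕ) → 1 ≤ k → n ≡ 3 ^ k → ∀ (s r : ℕ) → IsDTSize (iter MAJ3 k) s → IsRank (iter MAJ3 k) r → 2 ^ r ≤ s × n / 3 + 1 ≤ r)
    × (∀ (k n : ℕ) → 1 ≤ k → n ≡ 4 ^ k → ∀ (s r : ℕ) → IsDTSize (iter AND2∘OR2 k) s → IsRank (iter AND2∘OR2 k) r → 2 ^ r ≤ s × n / 4 + 1 ≤ r)
corollary7p1 = majority , andOr
  where
  majority : ∀ (k n : ℕ) → 1 ≤ k → n ≡ 3 ^ k → ∀ (s r : ℕ) → IsDTSize (iter MAJ3 k) s → IsRank (iter MAJ3 k) r → 2 ^ r ≤ s × n / 3 + 1 ≤ r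
  majority (suc k) _ _ refl _ _ size rnk =
    2^Rank≤DTSize size rnk , m^[1+k]/m+1≤ 3 k (Majority.3^k≤initial k) (Majority.initial<Rank (suc k) rnk)
  andOr : ∀ (k n : ℕ) → 1 ≤ k → n ≡ 4 ^ k → ∀ (s r : ℕ) → IsDTSize (iter AND2∘OR2 k) s → IsRank (iter AND2∘OR2 k) r → 2 ^ r ≤ s × n / 4 + 1 ≤ r
  andOr (suc k) _ _ refl _ _ size rnk =
    2^Rank≤DTSize size rnk , m^[1+k]/m+1≤ 4 k (AndOr.4^k≤initial k) (AndOr.initial<Rank (suc k) rnk)
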